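{- Let $t\ge 1$ be real and let $G$ be an $n$-vertex $t$-tough graph, and let $C$ be a non-hamiltonian cycle of $G$. If a vertex $x\in V(G)\setminus V(C)$ satisfies $\deg(x,C)>\frac{n}{t+1}$, then $G$ has a cycle $C'$ with $V(C')=V(C)\cup\{x\}$.
   Context: Graphs are finite, simple, undirected. $c(H)$ is the number of components of $H$. $G$ is $t$-tough if $|S|\ge t\cdot c(G-S)$ for every $S\subseteq V(G)$ with $c(G-S)\ge 2$. A cycle is non-hamiltonian if it does not contain all vertices of $G$. For a vertex $x$ and a subgraph $C$, $\deg(x,C)=|N_G(x)\cap V(C)|$, the number of neighbors of $x$ in $V(C)$.
   Formalization: The toughness parameter t ranges over the rationals instead of the reals. -}

module Defs where

open import Data.Nat using (ℕ; zero; suc; _≤_)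
open import Data.Fin using (Fin)
open import Data.Fin.Subset using (Subset; _∈_; _∉_; ∣_∣)
open import Data.Bool using (Bool; true; false)
open import Data.List using (List; []; _∷_; _++_; [_]; length; filterᵇ)
open import Data.List.Relation.Unary.Linked using (Linked)
open import Data.List.Relation.Unary.Unique.Propositional using (Unique)
open import Data.List.Membership.Propositional using () renaming (_∈_ to _∈ₗ_)
open import Data.Product using (Σ; _×_; _,_)
open import Data.Integer using (+_)
open import Data.Rational using (ℚ; _/_; _*_) renaming (_≤_ to _≤ℚ_)
open import Relation.Binary.PropositionalEquality using (_≡_)
open import Function using (Surjective)
open import Data.Empty using (⊥)

record Graph (n : ℕ) : Set where
  field
    edge  : Fin n → Fin n → Bool
    sym   : ∀ u v → edge u v ≡ edge v u
    irref : ∀ v → edge v v ≡ false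

  Adj : Fin n → Fin n → Set
  Adj u v = edge u v ≡ true

open Graph public

ℕ→ℚ : ℕ → ℚ
ℕ→ℚ k = + k / 1

module _ {n : ℕ} (G : Graph n) where

  -- Connectivity in G - S: a walk from u to v using only vertices outside S
  -- (u itself is assumed to lie outside S by the users of this relation).
  data Reach (S : Subset n) : Fin n → Fin n → Set where
    here : ∀ {u} → Reach S u u
    step : ∀ {u w v} → Adj G u w → w ∉ S → Reach S w v → Reach S u v

  Outside : Subset n → Set
  Outside S = Σ (Fin n) (λ v → v ∉ S)

  -- c(G - S) = c: there is a surjection from V(G - S) onto Fin c whose fibres
  -- are exactly the connected components of G - S.
  HasComponents : Subset n → ℕ → Set
  HasComponents S c =
    Σ (Outside S → Fin c) λ f →
      Surjective _≡_ _≡_ f ×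
      (∀ (u v : Outside S) → (f u ≡ f v → Reach S (Σ.proj₁ u) (Σ.proj₁ v))
                           × (Reach S (Σ.proj₁ u) (Σ.proj₁ v) → f u ≡ f v))

  Tough : ℚ → Set
  Tough t = ∀ (S : Subset n) (c : ℕ) → HasComponents S c → 2 ≤ c →
            t * ℕ→ℚ c ≤ℚ ℕ→ℚ ∣ S ∣

  IsCycle : List (Fin n) → Set
  IsCycle []       = ⊥
  IsCycle (v ∷ vs) = (3 ≤ length (v ∷ vs)) × Unique (v ∷ vs) × Linked (Adj G) ((v ∷ vs) ++ [ v ])

  degIn : Fin n → List (Fin n) → ℕ
  degIn x C = length (filterᵇ (edge G x) C)

{-# OPTIONS --safe #-}
module Submission where

-- Let N⁺ be the set of successors, along C, of the neighbours of x on C; it is in bijection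
-- with those neighbours, so |N⁺| = deg(x, C).  If x is adjacent to some u⁺ ∈ N⁺, then x can
-- be inserted between u and u⁺.  If two vertices u⁺, v⁺ ∈ N⁺ are adjacent, with u before v,
-- then x v … u⁺ v⁺ … u x (the segment from u⁺ to v traversed backwards) is the required cycle.
-- Otherwise {x} ∪ N⁺ is an independent set of size deg(x, C) + 1 ≥ 2; deleting all other
-- vertices leaves that many isolated vertices, so toughness gives
-- (t + 1) (deg(x, C) + 1) ≤ n, contradicting n < (t + 1) deg(x, C).

open import Defs hiding (sym)
open import Data.Nat using (ℕ)
open import Data.Fin using (Fin)
open import Data.List using (List)
open import Data.List.Membership.Propositional using (_∈_; _∉_)
open import Data.Rational using (ℚ; 1ℚ; _+_; _*_; _≤_; _<_)
open import Data.Product using (Σ; ∃; _×_)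
open import Data.Sum using (_⊎_)
open import Relation.Binary.PropositionalEquality using (_≡_)

open import Data.Bool using (Bool; true; false; if_then_else_)
import Data.Bool as Bool
open import Data.Empty using (⊥-elim)
open import Data.Fin.Subset using (Subset; ⁅_⁆; _∪_; ∁; ⋃; ∣_∣)
  renaming (_∈_ to _∈ₛ_; _∉_ to _∉ₛ_)
open import Data.Fin.Subset.Properties
  using (x∈⁅x⁆; x∈⁅y⁆⇒x≡y; x∈p∪q⁺; x∈p∪q⁻; q⊆p∪q; p⊂q⇒∣p∣<∣q∣; ∉⊥; ∣p∣≤n; ∣∁p∣≡n∸∣p∣;
         x∈p⇒x∉∁p; x∉∁p⇒x∈p)
open import Data.Integer as ℤ using (+_; +≤+)
import Data.Integer.Properties as ℤ
open import Data.List as List using ([]; _∷_; _++_; [_]; _∷ʳ_; length; reverse; filterᵇ; map; lookup)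
open import Data.List.Properties using (++-assoc; ∷ʳ-++; ∷ʳ-injective; ∷-injective; reverse-++; unfold-reverse)
open import Data.List.Membership.Propositional using (find; lose)
open import Data.List.Membership.Propositional.Properties using (∈-lookup)
open import Data.List.Membership.Propositional.Properties.WithK using (unique⇒irrelevant)
import Data.List.Membership.Setoid.Properties as SetoidMembership
import Data.List.Relation.Unary.All as All
open import Data.List.Relation.Unary.All.Properties using (¬Any⇒All¬)
open import Data.List.Relation.Unary.Any using (here; there; index; any?)
open import Data.List.Relation.Unary.AllPairs using ([]; _∷_)
open import Data.List.Relation.Unary.Linked as Linked using (Linked; []; [-]; _∷_)
open import Data.List.Relation.Unary.Unique.Propositional using (Unique)
open import Data.List.Relation.Binary.Permutation.Propositional
  using (_↭_; prep; ↭-reflexive; ↭-sym; ↭-trans; ↭⇒↭ₛ; module PermutationReasoning)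
open import Data.List.Relation.Binary.Permutation.Propositional.Properties as Perm
  using (∈-resp-↭; ++-comm; ↭-reverse; ∷↭∷ʳ; ↭-length; ++⁺ʳ)
import Data.List.Relation.Binary.Permutation.Setoid.Properties as SetoidPerm
open import Data.Nat as ℕ using (z≤n; s≤s; _∸_)
import Data.Nat.Properties as ℕ
open import Data.Nat.Coprimality using (1-coprimeTo) renaming (sym to coprime-sym)
open import Data.Product using (∃₂; _,_; proj₁; proj₂)
open import Data.Rational using (mkℚ; 0ℚ; _/_; *≤*; NonNegative; nonNegative)
open import Data.Rational.Properties
  using (normalize-coprime; ≤-trans; <-irrefl; +-monoˡ-≤; *-distribˡ-+; *-comm; *-identityʳ;
         *-zeroˡ; *-monoʳ-≤-nonNeg; nonNegative⁻¹; nonNeg+nonNeg⇒nonNeg; module ≤-Reasoning)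
open import Data.Sum using (inj₁; inj₂; [_,_]′)
import Data.Vec as Vec
open import Data.Fin using (#_)
open import Relation.Binary.Definitions using (Symmetric)
open import Relation.Binary.PropositionalEquality
  using (refl; sym; trans; cong; cong₂; subst; setoid; module ≡-Reasoning)
open import Relation.Nullary using (¬_; yes; no)
open import Function using (_∘_)

ℕ→ℚ≡mkℚ : ∀ k → ℕ→ℚ k ≡ mkℚ (+ k) 0 (coprime-sym (1-coprimeTo k))
ℕ→ℚ≡mkℚ k = normalize-coprime (coprime-sym (1-coprimeTo k))

ℕ→ℚ-+ : ∀ a b → ℕ→ℚ (a ℕ.+ b) ≡ ℕ→ℚ a + ℕ→ℚ b
ℕ→ℚ-+ a b rewrite ℕ→ℚ≡mkℚ a | ℕ→ℚ≡mkℚ b =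
  cong (_/ 1) (sym (cong₂ ℤ._+_ (ℤ.*-identityʳ (+ a)) (ℤ.*-identityʳ (+ b))))

ℕ→ℚ-mono-≤ : ∀ {a b} → a ℕ.≤ b → ℕ→ℚ a ≤ ℕ→ℚ b
ℕ→ℚ-mono-≤ {a} {b} a≤b rewrite ℕ→ℚ≡mkℚ a | ℕ→ℚ≡mkℚ b =
  *≤* (ℤ.*-monoʳ-≤-nonNeg (+ 1) (+≤+ a≤b))

ℕ→ℚ<*⇒0< : ∀ {m k} q → ℕ→ℚ m < ℕ→ℚ k * q → 0 ℕ.< k
ℕ→ℚ<*⇒0< {m} {ℕ.zero} q m<0 = ⊥-elim (<-irrefl refl (begin-strict
  0ℚ          ≤⟨ ℕ→ℚ-mono-≤ {0} {m} z≤n ⟩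
  ℕ→ℚ m       <⟨ m<0 ⟩
  0ℚ * q      ≡⟨ *-zeroˡ q ⟩
  0ℚ          ∎))
  where open ≤-Reasoning
ℕ→ℚ<*⇒0< {k = ℕ.suc k} _ _ = s≤s z≤n

module _ {A : Set} {R : A → A → Set} where

  Linked-prefix : ∀ xs {a ys} → Linked R (xs ++ a ∷ ys) → Linked R (xs ++ [ a ])
  Linked-prefix []           _        = [-]
  Linked-prefix (x ∷ [])     (r ∷ _)  = r ∷ [-]
  Linked-prefix (x ∷ y ∷ xs) (r ∷ rs) = r ∷ Linked-prefix (y ∷ xs) rs

  Linked-suffix : ∀ xs {ys} → Linked R (xs ++ ys) → Linked R ys
  Linked-suffix []       rs = rs
  Linked-suffix (x ∷ xs) rs = Linked-suffix xs (Linked.tail rs)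

  Linked-glue : ∀ xs {a} ys → Linked R (xs ++ [ a ]) → Linked R (a ∷ ys) → Linked R (xs ++ a ∷ ys)
  Linked-glue []           ys _        rs = rs
  Linked-glue (x ∷ [])     ys (r ∷ _)  rs = r ∷ rs
  Linked-glue (x ∷ y ∷ xs) ys (r ∷ qs) rs = r ∷ Linked-glue (y ∷ xs) ys qs rs

  Linked-reverse⁺ : Symmetric R → ∀ {xs} → Linked R xs → Linked R (reverse xs)
  Linked-reverse⁺ R-sym {[]}     _  = []
  Linked-reverse⁺ R-sym {a ∷ xs} rs = onto [] xs [-] rs
    where
    onto : ∀ {a} acc xs → Linked R (a ∷ acc) → Linked R (a ∷ xs) → Linked R (List.reverseAcc (a ∷ acc) xs)
    onto acc []       qs _        = qs
    onto acc (b ∷ xs) qs (r ∷ rs) = onto (_ ∷ acc) xs (R-sym r ∷ qs) rs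

module _ {A : Set} where

  ∷-∷ʳ : ∀ (b : A) B → ∃₂ λ Z e → b ∷ B ≡ Z ∷ʳ e
  ∷-∷ʳ b []       = [] , b , refl
  ∷-∷ʳ b (b′ ∷ B) = let Z , e , eq = ∷-∷ʳ b′ B in b ∷ Z , e , cong (b ∷_) eq

  ∷≡++∷ : ∀ {c : A} {cs} As {a} Z → c ∷ cs ≡ As ++ a ∷ Z → ∃ λ Y → As ++ [ a ] ≡ c ∷ Y × cs ≡ Y ++ Z
  ∷≡++∷ []        Z refl = [] , refl , refl
  ∷≡++∷ (_ ∷ As′) Z refl = As′ ++ [ _ ] , refl , sym (∷ʳ-++ As′ _ Z)

  -- Z ++ c ∷ Y is the cyclic list c ∷ cs re-read from b.
  cut-closed-walk : ∀ (c : A) cs As {a b} B → c ∷ cs ++ [ c ] ≡ As ++ a ∷ b ∷ B →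
                    ∃₂ λ Y Z → As ++ [ a ] ≡ c ∷ Y × b ∷ B ≡ Z ++ [ c ] × cs ≡ Y ++ Z
  cut-closed-walk c cs As {a} {b} B eq with ∷-∷ʳ b B
  ... | Z , e , b∷B≡ with ∷ʳ-injective (c ∷ cs) (As ++ a ∷ Z) (begin
        c ∷ cs ++ [ c ]      ≡⟨ eq ⟩
        As ++ a ∷ b ∷ B      ≡⟨ cong (λ w → As ++ a ∷ w) b∷B≡ ⟩
        As ++ a ∷ Z ∷ʳ e     ≡⟨ ++-assoc As (a ∷ Z) [ e ] ⟨
        (As ++ a ∷ Z) ∷ʳ e   ∎)
    where open ≡-Reasoning
  ... | c∷cs≡ , refl = let Y , As∷a≡ , cs≡ = ∷≡++∷ As Z c∷cs≡ in Y , Z , As∷a≡ , b∷B≡ , cs≡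

  ++-≡-shorter-prefix : ∀ (As₁ As₂ X Y : List A) → As₁ ++ X ≡ As₂ ++ Y → length As₁ ℕ.≤ length As₂ →
                        ∃ λ D → X ≡ D ++ Y
  ++-≡-shorter-prefix []        As₂       X Y eq _         = As₂ , eq
  ++-≡-shorter-prefix (_ ∷ As₁) (_ ∷ As₂) X Y eq (s≤s le) =
    ++-≡-shorter-prefix As₁ As₂ X Y (proj₂ (∷-injective eq)) le

  index-∈-lookup : ∀ (xs : List A) i → index (∈-lookup {xs = xs} i) ≡ i
  index-∈-lookup (x ∷ xs) Fin.zero    = refl
  index-∈-lookup (x ∷ xs) (Fin.suc i) = cong Fin.suc (index-∈-lookup xs i)

  open import Algebra.Solver.CommutativeMonoid (Perm.++-commutativeMonoid {A = A}) using (Expr; prove; var; _⊕_)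

  reroute-↭ : ∀ (v u⁺ u : A) P Z As → v ∷ P ++ u⁺ ∷ Z ++ As ++ [ u ] ↭ ((As ++ u ∷ u⁺ ∷ P) ++ [ v ]) ++ Z
  reroute-↭ v u⁺ u P Z As =
    prove 6 (V ⊕ (P′ ⊕ (U⁺ ⊕ (Z′ ⊕ (As′ ⊕ U))))) (((As′ ⊕ (U ⊕ (U⁺ ⊕ P′))) ⊕ V) ⊕ Z′)
            ([ v ] Vec.∷ P Vec.∷ [ u⁺ ] Vec.∷ Z Vec.∷ As Vec.∷ [ u ] Vec.∷ Vec.[])
    where
    V P′ U⁺ Z′ As′ U : Expr 6
    V   = var (# 0)
    P′  = var (# 1)
    U⁺  = var (# 2)
    Z′  = var (# 3)
    As′ = var (# 4)
    U   = var (# 5)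

  successors : (A → Bool) → List A → List A
  successors p []          = []
  successors p (a ∷ [])    = []
  successors p (a ∷ b ∷ r) = if p a then b ∷ successors p (b ∷ r) else successors p (b ∷ r)

  ∈-successors⇒∈-tail : ∀ p a r {y} → y ∈ successors p (a ∷ r) → y ∈ r
  ∈-successors⇒∈-tail p a (b ∷ r) y∈ with p a | y∈
  ... | true  | here refl = here refl
  ... | true  | there y∈′ = there (∈-successors⇒∈-tail p b r y∈′)
  ... | false | y∈′       = there (∈-successors⇒∈-tail p b r y∈′)

  successors-unique : ∀ p a {r} → Unique r → Unique (successors p (a ∷ r))
  successors-unique p a {[]}    _           = []
  successors-unique p a {b ∷ r} (b∉r ∷ r!) with p a
  ... | true  = All.tabulate (λ y∈ → All.lookup b∉r (∈-successors⇒∈-tail p b r y∈)) ∷ successors-unique p b r!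
  ... | false = successors-unique p b r!

  Follows : (A → Bool) → A → List A → Set
  Follows p y W = ∃₂ λ As a → ∃ λ B → W ≡ As ++ a ∷ y ∷ B × p a ≡ true

  Follows-∷ : ∀ {p y W} b → Follows p y W → Follows p y (b ∷ W)
  Follows-∷ b (As , a , B , eq , pa) = b ∷ As , a , B , cong (b ∷_) eq , pa

  ∈-successors⁻ : ∀ p a r {y} → y ∈ successors p (a ∷ r) → Follows p y (a ∷ r)
  ∈-successors⁻ p a (b ∷ r) y∈ with p a in pa | y∈
  ... | true  | here refl = [] , a , r , refl , pa
  ... | true  | there y∈′ = Follows-∷ a (∈-successors⁻ p b r y∈′)
  ... | false | y∈′       = Follows-∷ a (∈-successors⁻ p b r y∈′)

  length-successors : ∀ p a xs c → length (successors p (a ∷ xs ++ [ c ])) ≡ length (filterᵇ p (a ∷ xs))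
  length-successors p a []       c with p a
  ... | true  = refl
  ... | false = refl
  length-successors p a (b ∷ xs) c with p a
  ... | true  = cong ℕ.suc (length-successors p b xs c)
  ... | false = length-successors p b xs c

module _ {n : ℕ} (G : Graph n) where

  Adj-sym : ∀ {u v} → Adj G u v → Adj G v u
  Adj-sym {u} {v} uv = trans (Graph.sym G v u) uv

  Adj-irrefl : ∀ {v} → ¬ Adj G v v
  Adj-irrefl {v} vv with trans (sym (irref G v)) vv
  ... | ()

  Independent : List (Fin n) → Set
  Independent I = ∀ {y z} → y ∈ I → z ∈ I → ¬ Adj G y z

  independent⊎edge : ∀ I → Independent I ⊎ ∃₂ λ y z → y ∈ I × z ∈ I × Adj G y z
  independent⊎edge I with any? (λ y → any? (λ z → edge G y z Bool.≟ true) I) I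
  ... | no  noEdge = inj₁ λ y∈ z∈ yz → noEdge (lose y∈ (lose z∈ yz))
  ... | yes someEdge =
    let y , y∈ , y-edge = find someEdge
        z , z∈ , yz     = find y-edge
    in inj₂ (y , z , y∈ , z∈ , yz)

module _ {n : ℕ} where

  fromList : List (Fin n) → Subset n
  fromList I = ⋃ (map ⁅_⁆ I)

  ∈-fromList⁺ : ∀ {v I} → v ∈ I → v ∈ₛ fromList I
  ∈-fromList⁺ {I = w ∷ I} (here refl) = x∈p∪q⁺ (inj₁ (x∈⁅x⁆ w))
  ∈-fromList⁺ {I = w ∷ I} (there v∈) = x∈p∪q⁺ (inj₂ (∈-fromList⁺ v∈))

  ∈-fromList⁻ : ∀ {v} I → v ∈ₛ fromList I → v ∈ I
  ∈-fromList⁻ []      v∈ = ⊥-elim (∉⊥ v∈)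
  ∈-fromList⁻ (w ∷ I) v∈ with x∈p∪q⁻ ⁅ w ⁆ (fromList I) v∈
  ... | inj₁ v∈⁅w⁆ = here (x∈⁅y⁆⇒x≡y w v∈⁅w⁆)
  ... | inj₂ v∈I   = there (∈-fromList⁻ I v∈I)

  length≤∣fromList∣ : ∀ {I} → Unique I → length I ℕ.≤ ∣ fromList I ∣
  length≤∣fromList∣ {[]}    _           = z≤n
  length≤∣fromList∣ {v ∷ I} (v∉I ∷ I!) = ℕ.≤-trans (s≤s (length≤∣fromList∣ I!))
    (p⊂q⇒∣p∣<∣q∣ (q⊆p∪q ⁅ v ⁆ (fromList I) , v , x∈p∪q⁺ (inj₁ (x∈⁅x⁆ v)) ,
                  λ v∈ → All.lookup v∉I (∈-fromList⁻ I v∈) refl))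

  ∣∁fromList∣+length≤n : ∀ {I} → Unique I → ∣ ∁ (fromList I) ∣ ℕ.+ length I ℕ.≤ n
  ∣∁fromList∣+length≤n {I} I! = begin
    ∣ ∁ (fromList I) ∣ ℕ.+ length I        ≡⟨ cong (ℕ._+ length I) (∣∁p∣≡n∸∣p∣ (fromList I)) ⟩
    n ∸ ∣ fromList I ∣ ℕ.+ length I        ≤⟨ ℕ.+-monoʳ-≤ (n ∸ ∣ fromList I ∣) (length≤∣fromList∣ I!) ⟩
    n ∸ ∣ fromList I ∣ ℕ.+ ∣ fromList I ∣  ≡⟨ ℕ.m∸n+n≡m (∣p∣≤n (fromList I)) ⟩
    n                                      ∎
    where open ℕ.≤-Reasoning

module _ {n : ℕ} (G : Graph n) {I : List (Fin n)} (I! : Unique I) (I-independent : Independent G I) where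

  private
    S : Subset n
    S = ∁ (fromList I)

    ∉S⇒∈I : ∀ {v} → v ∉ₛ S → v ∈ I
    ∉S⇒∈I v∉S = ∈-fromList⁻ I (x∉∁p⇒x∈p v∉S)

    position : Outside G S → Fin (length I)
    position (v , v∉S) = index (∉S⇒∈I v∉S)

    position-≡ : ∀ {u v} (u∉S : u ∉ₛ S) (v∉S : v ∉ₛ S) → u ≡ v → position (u , u∉S) ≡ position (v , v∉S)
    position-≡ u∉S v∉S refl = cong index (unique⇒irrelevant I! (∉S⇒∈I u∉S) (∉S⇒∈I v∉S))

    Reach⇒≡ : ∀ {u v} → u ∈ I → Reach G S u v → u ≡ v
    Reach⇒≡ _   here           = refl
    Reach⇒≡ u∈I (step uw w∉S _) = ⊥-elim (I-independent u∈I (∉S⇒∈I w∉S) uw)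

  independent⇒components : HasComponents G (∁ (fromList I)) (length I)
  independent⇒components = position , surjective , λ u v → same-position⇒Reach u v , Reach⇒same-position u v
    where
    surjective : ∀ i → ∃ λ u → ∀ {w} → w ≡ u → position w ≡ i
    surjective i = (lookup I i , x∈p⇒x∉∁p (∈-fromList⁺ (∈-lookup {xs = I} i))) , λ where
      refl → trans (cong index (unique⇒irrelevant I! _ (∈-lookup i))) (index-∈-lookup I i)
    same-position⇒Reach : ∀ (u v : Outside G S) → position u ≡ position v → Reach G S (proj₁ u) (proj₁ v)
    same-position⇒Reach (u , u∉S) (v , v∉S) eq =
      subst (Reach G S u) (SetoidMembership.index-injective (setoid (Fin n)) (∉S⇒∈I u∉S) (∉S⇒∈I v∉S) eq) here
    Reach⇒same-position : ∀ (u v : Outside G S) → Reach G S (proj₁ u) (proj₁ v) → position u ≡ position v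
    Reach⇒same-position (u , u∉S) (v , v∉S) r = position-≡ u∉S v∉S (Reach⇒≡ (∉S⇒∈I u∉S) r)

  independent-set-bound : ∀ {t} → Tough G t → 2 ℕ.≤ length I → ℕ→ℚ (length I) * (t + 1ℚ) ≤ ℕ→ℚ n
  independent-set-bound {t} tough 2≤∣I∣ = begin
    ℕ→ℚ k * (t + 1ℚ)            ≡⟨ *-distribˡ-+ (ℕ→ℚ k) t 1ℚ ⟩
    ℕ→ℚ k * t + ℕ→ℚ k * 1ℚ      ≡⟨ cong₂ _+_ (*-comm (ℕ→ℚ k) t) (*-identityʳ (ℕ→ℚ k)) ⟩
    t * ℕ→ℚ k + ℕ→ℚ k           ≤⟨ +-monoˡ-≤ (ℕ→ℚ k) (tough S k independent⇒components 2≤∣I∣) ⟩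
    ℕ→ℚ ∣ S ∣ + ℕ→ℚ k           ≡⟨ ℕ→ℚ-+ ∣ S ∣ k ⟨
    ℕ→ℚ (∣ S ∣ ℕ.+ k)           ≤⟨ ℕ→ℚ-mono-≤ (∣∁fromList∣+length≤n I!) ⟩
    ℕ→ℚ n                       ∎
    where
    open ≤-Reasoning
    k : ℕ
    k = length I

Unique-resp-↭ : ∀ {A : Set} {xs ys : List A} → xs ↭ ys → Unique xs → Unique ys
Unique-resp-↭ xs↭ys = SetoidPerm.Unique-resp-↭ (setoid _) (↭⇒↭ₛ xs↭ys)

CycleOn : ∀ {n} → Graph n → (Fin n → Set) → Set
CycleOn {n} G P = Σ (List (Fin n)) λ C′ → IsCycle G C′ × (∀ v → (v ∈ C′ → P v) × (P v → v ∈ C′))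

module Extension {n : ℕ} (G : Graph n) (x c : Fin n) (cs : List (Fin n))
                 (3≤∣C∣ : 3 ℕ.≤ length (c ∷ cs)) (C! : Unique (c ∷ cs))
                 (C-closed : Linked (Adj G) (c ∷ cs ++ [ c ])) (x∉C : x ∉ c ∷ cs) where

  C W : List (Fin n)
  C = c ∷ cs
  W = C ++ [ c ]

  Extended : Set
  Extended = CycleOn G (λ v → v ∈ C ⊎ v ≡ x)

  cycle-through-x : ∀ M → M ↭ C → Linked (Adj G) (x ∷ M ++ [ x ]) → Extended
  cycle-through-x M M↭C closed = x ∷ M , (3≤∣x∷M∣ , x∷M! , closed) , λ v → to v , from v
    where
    3≤∣x∷M∣ : 3 ℕ.≤ length (x ∷ M)
    3≤∣x∷M∣ = ℕ.m≤n⇒m≤1+n (subst (3 ℕ.≤_) (sym (↭-length M↭C)) 3≤∣C∣)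
    x∷M! : Unique (x ∷ M)
    x∷M! = Unique-resp-↭ (prep x (↭-sym M↭C)) (¬Any⇒All¬ C x∉C ∷ C!)
    to : ∀ v → v ∈ x ∷ M → v ∈ C ⊎ v ≡ x
    to v (here v≡x)  = inj₂ v≡x
    to v (there v∈M) = inj₁ (∈-resp-↭ M↭C v∈M)
    from : ∀ v → v ∈ C ⊎ v ≡ x → v ∈ x ∷ M
    from v (inj₁ v∈C) = there (∈-resp-↭ (↭-sym M↭C) v∈C)
    from v (inj₂ v≡x) = here v≡x

  W-linked : ∀ {V} → W ≡ V → Linked (Adj G) V
  W-linked W≡V = subst (Linked (Adj G)) W≡V C-closed

  close-at-x : ∀ P Y → Linked (Adj G) (x ∷ P ++ [ c ]) → Linked (Adj G) (c ∷ Y ++ [ x ]) →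
               Linked (Adj G) (x ∷ (P ++ c ∷ Y) ++ [ x ])
  close-at-x P Y x⇝c c⇝x =
    subst (λ w → Linked (Adj G) (x ∷ w)) (sym (++-assoc P (c ∷ Y) [ x ])) (Linked-glue (x ∷ P) (Y ++ [ x ]) x⇝c c⇝x)

  return-to-x : ∀ As {u} B Y → W ≡ As ++ u ∷ B → As ++ [ u ] ≡ c ∷ Y → Adj G x u → Linked (Adj G) (c ∷ Y ++ [ x ])
  return-to-x As {u} B Y W≡ As∷u≡ xu =
    subst (λ w → Linked (Adj G) (w ++ [ x ])) As∷u≡
      (subst (Linked (Adj G)) (sym (∷ʳ-++ As u [ x ]))
        (Linked-glue As [ x ] (Linked-prefix As (W-linked W≡)) (Adj-sym G xu ∷ [-])))

  insert-between : ∀ As {a b} B → W ≡ As ++ a ∷ b ∷ B → Adj G x a → Adj G x b → Extended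
  insert-between As {b = b} B W≡ xa xb with cut-closed-walk c cs As B W≡
  ... | Y , Z , As∷a≡ , b∷B≡ , cs≡ =
    cycle-through-x (Z ++ c ∷ Y) Z∷c∷Y↭C (close-at-x Z Y x⇝c (return-to-x As (b ∷ B) Y W≡ As∷a≡ xa))
    where
    Z∷c∷Y↭C : Z ++ c ∷ Y ↭ C
    Z∷c∷Y↭C = ↭-trans (++-comm Z (c ∷ Y)) (↭-reflexive (cong (c ∷_) (sym cs≡)))
    x⇝c : Linked (Adj G) (x ∷ Z ++ [ c ])
    x⇝c = subst (λ w → Linked (Adj G) (x ∷ w)) b∷B≡ (xb ∷ Linked.tail (Linked-suffix As (W-linked W≡)))

  reroute : ∀ As {u u⁺} P {v v⁺} B → W ≡ As ++ u ∷ u⁺ ∷ P ++ v ∷ v⁺ ∷ B →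
            Adj G x u → Adj G x v → Adj G u⁺ v⁺ → Extended
  reroute As {u} {u⁺} P {v} {v⁺} B W≡ xu xv u⁺v⁺
    with cut-closed-walk c cs As (P ++ v ∷ v⁺ ∷ B) W≡
       | cut-closed-walk c cs (As ++ u ∷ u⁺ ∷ P) B (trans W≡ (sym (++-assoc As (u ∷ u⁺ ∷ P) (v ∷ v⁺ ∷ B))))
  ... | Y , _ , As∷u≡ , _ , _ | Y′ , Z , As∷u∷u⁺∷P∷v≡ , v⁺∷B≡ , cs≡ =
    cycle-through-x M M↭C (close-at-x (v ∷ reverse P ++ u⁺ ∷ Z) Y x⇝c (return-to-x As _ Y W≡ As∷u≡ xu))
    where
    M : List (Fin n)
    M = (v ∷ reverse P ++ u⁺ ∷ Z) ++ c ∷ Y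
    u⁺⇝v⇝ : Linked (Adj G) (u⁺ ∷ P ++ v ∷ v⁺ ∷ B)
    u⁺⇝v⇝ = Linked.tail (Linked-suffix As (W-linked W≡))
    v⇝u⁺ : Linked (Adj G) (v ∷ reverse P ++ [ u⁺ ])
    v⇝u⁺ = subst (Linked (Adj G))
      (trans (reverse-++ (u⁺ ∷ P) [ v ]) (cong (v ∷_) (unfold-reverse u⁺ P)))
      (Linked-reverse⁺ (Adj-sym G) (Linked-prefix (u⁺ ∷ P) u⁺⇝v⇝))
    u⁺⇝c : Linked (Adj G) (u⁺ ∷ Z ++ [ c ])
    u⁺⇝c = subst (λ w → Linked (Adj G) (u⁺ ∷ w)) v⁺∷B≡ (u⁺v⁺ ∷ Linked.tail (Linked-suffix (u⁺ ∷ P) u⁺⇝v⇝))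
    x⇝c : Linked (Adj G) (x ∷ (v ∷ reverse P ++ u⁺ ∷ Z) ++ [ c ])
    x⇝c = subst (λ w → Linked (Adj G) (x ∷ v ∷ w)) (sym (++-assoc (reverse P) (u⁺ ∷ Z) [ c ]))
      (xv ∷ Linked-glue (v ∷ reverse P) (Z ++ [ c ]) v⇝u⁺ u⁺⇝c)
    M↭C : M ↭ C
    M↭C = begin
      (v ∷ reverse P ++ u⁺ ∷ Z) ++ c ∷ Y   ≡⟨ cong (v ∷_) (++-assoc (reverse P) (u⁺ ∷ Z) (c ∷ Y)) ⟩
      v ∷ reverse P ++ u⁺ ∷ Z ++ c ∷ Y     ↭⟨ prep v (++⁺ʳ (u⁺ ∷ Z ++ c ∷ Y) (↭-reverse P)) ⟩
      v ∷ P ++ u⁺ ∷ Z ++ c ∷ Y             ≡⟨ cong (λ w → v ∷ P ++ u⁺ ∷ Z ++ w) As∷u≡ ⟨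
      v ∷ P ++ u⁺ ∷ Z ++ As ++ [ u ]       ↭⟨ reroute-↭ v u⁺ u P Z As ⟩
      ((As ++ u ∷ u⁺ ∷ P) ++ [ v ]) ++ Z   ≡⟨ cong (_++ Z) As∷u∷u⁺∷P∷v≡ ⟩
      c ∷ Y′ ++ Z                          ≡⟨ cong (c ∷_) cs≡ ⟨
      C                                    ∎
      where open PermutationReasoning

  N⁺ : List (Fin n)
  N⁺ = successors (edge G x) W

  x∷N⁺! : Unique (x ∷ N⁺)
  x∷N⁺! = ¬Any⇒All¬ N⁺ (λ x∈N⁺ → x∉C (N⁺⊆C x∈N⁺)) ∷ successors-unique (edge G x) c (Unique-resp-↭ (∷↭∷ʳ c cs) C!)
    where
    N⁺⊆C : ∀ {y} → y ∈ N⁺ → y ∈ C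
    N⁺⊆C y∈ = ∈-resp-↭ (↭-sym (∷↭∷ʳ c cs)) (∈-successors⇒∈-tail (edge G x) c (cs ++ [ c ]) y∈)

  ∣N⁺∣≡deg : length N⁺ ≡ degIn G x C
  ∣N⁺∣≡deg = length-successors (edge G x) c cs c

  ordered-successors : ∀ As₁ {a₁ y} B₁ As₂ {a₂ z} B₂ → W ≡ As₁ ++ a₁ ∷ y ∷ B₁ → W ≡ As₂ ++ a₂ ∷ z ∷ B₂ →
                       length As₁ ℕ.≤ length As₂ → Adj G x a₁ → Adj G x a₂ → Adj G y z → Extended
  ordered-successors As₁ B₁ As₂ B₂ W≡₁ W≡₂ As₁≤As₂ xa₁ xa₂ yz
    with ++-≡-shorter-prefix As₁ As₂ _ _ (trans (sym W≡₁) W≡₂) As₁≤As₂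
  ... | []        , refl = ⊥-elim (Adj-irrefl G yz)
  ... | _ ∷ []    , refl = insert-between As₁ _ W≡₁ xa₁ xa₂
  ... | _ ∷ _ ∷ P , refl = reroute As₁ P B₂ W≡₁ xa₁ xa₂ yz

  edge-in-x∷N⁺ : ∀ {y z} → y ∈ x ∷ N⁺ → z ∈ x ∷ N⁺ → Adj G y z → Extended
  edge-in-x∷N⁺ (here refl) (here refl) xx = ⊥-elim (Adj-irrefl G xx)
  edge-in-x∷N⁺ (here refl) (there z∈) xz =
    let As , _ , B , W≡ , xa = ∈-successors⁻ (edge G x) c (cs ++ [ c ]) z∈ in insert-between As B W≡ xa xz
  edge-in-x∷N⁺ (there y∈) (here refl) yx =
    let As , _ , B , W≡ , xa = ∈-successors⁻ (edge G x) c (cs ++ [ c ]) y∈ in insert-between As B W≡ xa (Adj-sym G yx)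
  edge-in-x∷N⁺ (there y∈) (there z∈) yz
    with ∈-successors⁻ (edge G x) c (cs ++ [ c ]) y∈ | ∈-successors⁻ (edge G x) c (cs ++ [ c ]) z∈
  ... | As₁ , _ , B₁ , W≡₁ , xa₁ | As₂ , _ , B₂ , W≡₂ , xa₂ with ℕ.≤-total (length As₁) (length As₂)
  ...   | inj₁ As₁≤As₂ = ordered-successors As₁ B₁ As₂ B₂ W≡₁ W≡₂ As₁≤As₂ xa₁ xa₂ yz
  ...   | inj₂ As₂≤As₁ = ordered-successors As₂ B₂ As₁ B₁ W≡₂ W≡₁ As₂≤As₁ xa₂ xa₁ (Adj-sym G yz)

lemma2p6 : (n : ℕ) (G : Graph n) (t : ℚ) → 1ℚ ≤ t → Tough G t →
           (C : List (Fin n)) → IsCycle G C → (∃ λ v → v ∉ C) →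
           (x : Fin n) → x ∉ C →
           ℕ→ℚ n < ℕ→ℚ (degIn G x C) * (t + 1ℚ) →
           Σ (List (Fin n)) λ C' → IsCycle G C' ×
             (∀ v → (v ∈ C' → v ∈ C ⊎ v ≡ x) × (v ∈ C ⊎ v ≡ x → v ∈ C'))
lemma2p6 n G t 1≤t tough (c ∷ cs) (3≤∣C∣ , C! , C-closed) _ x x∉C n<deg·[t+1] =
  [ ⊥-elim ∘ x∷N⁺-not-independent , from-edge ]′ (independent⊎edge G (x ∷ N⁺))
  where
  open Extension G x c cs 3≤∣C∣ C! C-closed x∉C

  from-edge : (∃₂ λ y z → y ∈ x ∷ N⁺ × z ∈ x ∷ N⁺ × Adj G y z) → Extended
  from-edge (_ , _ , y∈ , z∈ , yz) = edge-in-x∷N⁺ y∈ z∈ yz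

  deg : ℕ
  deg = degIn G x C

  instance
    t+1-nonNeg : NonNegative (t + 1ℚ)
    t+1-nonNeg = nonNeg+nonNeg⇒nonNeg t {{nonNegative (≤-trans (nonNegative⁻¹ 1ℚ) 1≤t)}} 1ℚ

  2≤∣x∷N⁺∣ : 2 ℕ.≤ length (x ∷ N⁺)
  2≤∣x∷N⁺∣ = s≤s (subst (1 ℕ.≤_) (sym ∣N⁺∣≡deg) (ℕ→ℚ<*⇒0< {n} {deg} (t + 1ℚ) n<deg·[t+1]))

  x∷N⁺-not-independent : ¬ Independent G (x ∷ N⁺)
  x∷N⁺-not-independent independent = <-irrefl refl (begin-strict
    ℕ→ℚ n                             <⟨ n<deg·[t+1] ⟩
    ℕ→ℚ deg * (t + 1ℚ)                ≤⟨ *-monoʳ-≤-nonNeg (t + 1ℚ) (ℕ→ℚ-mono-≤ (ℕ.n≤1+n deg)) ⟩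
    ℕ→ℚ (ℕ.suc deg) * (t + 1ℚ)        ≡⟨ cong (λ k → ℕ→ℚ (ℕ.suc k) * (t + 1ℚ)) ∣N⁺∣≡deg ⟨
    ℕ→ℚ (length (x ∷ N⁺)) * (t + 1ℚ)  ≤⟨ independent-set-bound G x∷N⁺! independent {t} tough 2≤∣x∷N⁺∣ ⟩
    ℕ→ℚ n                             ∎)
    where open ≤-Reasoning
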